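{- Let $A$ be a finite prefix-free set of pairs of strings, let $g$ and $h$ be bounding functions, and let $B$ be a set of pairs of strings. The following are equivalent: (1) there is a finite $(g,h)$-bushy forest system above $A$ all of whose leaves lie in $B$; (2) the set of strings $\tau$ (extending an element of $\operatorname{dom}A$) such that $B(\tau)$ is $h$-big above $A(\tau^{ -\operatorname{dom}A})$ is $g$-big above $\operatorname{dom}A$.
   Context: A bounding function is a computable function $\omega\to[2,\omega)$. Strings are elements of $\omega^{<\omega}$; $\sigma^{\preceq}$ is the set of strings extending $\sigma$, and for a set $C$ of strings $C^{\preceq}=\bigcup_{\sigma\in C}\sigma^{\preceq}$. A tree above $\sigma$ is a nonempty subset of $\sigma^{\preceq}$ closed under initial segments of length $\ge|\sigma|$; for a finite prefix-free set $D$ of strings, a forest above $D$ is a set $F\subseteq D^{\preceq}$ such that $F\cap\sigma^{\preceq}$ is a tree above $\sigma$ for each $\sigma\in D$. A leaf is an element with no proper extension in the forest; a forest is $h$-bushy if every non-leaf $\tau$ has at least $h(|\tau|)$ immediate successors (extensions of length $|\tau|+1$) in it. A finite forest $F'$ is an end-extension of $F$ if $F\subseteq F'$ and every string in $F'\setminus F$ extends a leaf of $F$. For sets of strings $D$ (finite prefix-free) and $E$, $E$ is $h$-big above $D$ if there is a finite $h$-bushy forest above $D$ all of whose leaves are in $E$; for a single string $\sigma$ use $D=\{\sigma\}$; for an arbitrary set $D$, $E$ is $h$-big above $D$ if it is $h$-big above every finite prefix-free subset of $D$. For a set $A$ of pairs of strings, $A(\tau)=\{\rho:(\tau,\rho)\in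 A\}$, $\operatorname{dom}A=\{\tau:A(\tau)\ne\emptyset\}$. $A$ is prefix-free if $\operatorname{dom}A$ is prefix-free and each $A(\tau)$ is prefix-free. If $D$ is a prefix-free set of strings and $\tau$ extends an element of $D$, $\tau^{ -D}$ denotes that unique element. A forest system above a finite prefix-free set $A$ of pairs is a set $T$ of pairs such that $\operatorname{dom}T$ is a forest above $\operatorname{dom}A$, for every $\tau\in\operatorname{dom}T$, $T(\tau)$ is a finite forest above $A(\tau^{ -\operatorname{dom}A})$, and if $\tau\prec\tau'$ are in $\operatorname{dom}T$ then $T(\tau')$ is an end-extension of $T(\tau)$. A leaf of $T$ is a pair $(\tau,\rho)\in T$ with $\tau$ a leaf of $\operatorname{dom}T$ and $\rho$ a leaf of $T(\tau)$. $T$ is $(g,h)$-bushy if $\operatorname{dom}T$ is $g$-bushy and every $T(\tau)$ is $h$-bushy. -}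

module Defs where

open import Data.Nat using (ℕ; _≤_)
open import Data.List using (List; _++_; [_]; length; map)
open import Data.List.Membership.Propositional using (_∈_)
open import Data.List.Relation.Unary.All using (All)
open import Data.List.Relation.Unary.Unique.Propositional using (Unique)
open import Data.Product using (_×_; _,_; ∃; ∃-syntax; proj₁)
open import Relation.Binary.PropositionalEquality using (_≡_)
open import Relation.Nullary using (¬_)

String : Set
String = List ℕ

_≼_ : String → String → Set
σ ≼ τ = ∃[ ρ ] (σ ++ ρ ≡ τ)

StrSet : Set₁
StrSet = String → Set

PairSet : Set₁
PairSet = String → String → Set

-- bounding function: values ≥ 2 (every Agda function ℕ → ℕ is computable)
Bounding : (ℕ → ℕ) → Set
Bounding h = ∀ n → 2 ≤ h n

PrefixFree : StrSet → Set
PrefixFree D = ∀ σ σ' → D σ → D σ' → σ ≼ σ' → σ ≡ σ'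

Forest : StrSet → StrSet → Set
Forest D F =
  (∀ τ → F τ → ∃[ σ ] (D σ × σ ≼ τ)) ×
  (∀ σ → D σ →
     (∃[ τ ] (F τ × σ ≼ τ)) ×
     (∀ τ ρ → F τ → σ ≼ τ → ρ ≼ τ → length σ ≤ length ρ → F ρ))

Leaf : StrSet → String → Set
Leaf F τ = F τ × (∀ τ' → F τ' → τ ≼ τ' → τ' ≡ τ)

Bushy : (ℕ → ℕ) → StrSet → Set
Bushy h F = ∀ τ → F τ → ¬ Leaf F τ →
  ∃[ ns ] (Unique ns × h (length τ) ≤ length ns × All (λ n → F (τ ++ [ n ])) ns)

-- E is h-big above a finite prefix-free D (only applied to finite prefix-free D):
-- there is a finite h-bushy forest above D all of whose leaves are in E.
Big : (ℕ → ℕ) → StrSet → StrSet → Set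
Big h D E = ∃[ F ] (Forest D (_∈ F) × Bushy h (_∈ F) × (∀ τ → Leaf (_∈ F) τ → E τ))

Pairs : Set
Pairs = List (String × String)

Sec : Pairs → String → StrSet
Sec A τ ρ = (τ , ρ) ∈ A

Dom : Pairs → StrSet
Dom A τ = ∃[ ρ ] ((τ , ρ) ∈ A)

PrefixFreePairs : Pairs → Set
PrefixFreePairs A = PrefixFree (Dom A) × (∀ τ → PrefixFree (Sec A τ))

EndExt : StrSet → StrSet → Set
EndExt F F' = (∀ ρ → F ρ → F' ρ) × (∀ ρ → F' ρ → ¬ F ρ → ∃[ λ' ] (Leaf F λ' × λ' ≼ ρ))

-- T is a forest system above A (T and A finite, given as lists).
-- τ^{-dom A} is the unique σ ∈ dom A with σ ≼ τ; we quantify over such σ.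
-- (T(τ) is automatically finite since T is.)
ForestSystem : Pairs → Pairs → Set
ForestSystem A T =
  Forest (Dom A) (Dom T) ×
  (∀ τ → Dom T τ → ∀ σ → Dom A σ → σ ≼ τ → Forest (Sec A σ) (Sec T τ)) ×
  (∀ τ τ' → Dom T τ → Dom T τ' → τ ≼ τ' → EndExt (Sec T τ) (Sec T τ'))

LeafSys : Pairs → String → String → Set
LeafSys T τ ρ = Sec T τ ρ × Leaf (Dom T) τ × Leaf (Sec T τ) ρ

BushySys : (ℕ → ℕ) → (ℕ → ℕ) → Pairs → Set
BushySys g h T = Bushy g (Dom T) × (∀ τ → Dom T τ → Bushy h (Sec T τ))

module Submission where

-- (1) ⇒ (2): dom T itself is the required g-bushy forest; at a leaf τ of dom T
--   the finite forest T(τ) witnesses that B(τ) is h-big above A(σ), σ = τ^{-dom A}.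
-- (2) ⇒ (1): given a g-bushy forest F above dom A whose leaves lie in the set
--   of (2), put T(τ) = A(σ) at the inner nodes τ of F and T(τ) = the h-bushy
--   forest witnessing bigness of B(τ) at the leaves of F.  Since A(σ) is
--   prefix-free it is an h-bushy forest consisting of leaves only, and every
--   forest above it end-extends it; this gives the forest-system conditions,
--   and dom T = F because every section is nonempty.
-- Neither direction uses that g and h are bounding functions.

open import Defs
open import Data.Nat using (ℕ; _≤_; s≤s)
import Data.Nat as ℕ
open import Data.Nat.Properties using (≤-refl)
open import Data.Product using (_×_; _,_; proj₁; proj₂; ∃-syntax)
open import Data.Sum as Sum using (_⊎_; inj₁; inj₂)
open import Data.Empty using (⊥-elim)
open import Data.List using (List; []; _∷_; _++_; length; map; filter; concatMap)
open import Data.List.Properties using (≡-dec; ++-identityʳ; ++-assoc; ∷-injective)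
open import Data.List.Membership.Propositional using (_∈_; lose; find)
open import Data.List.Membership.Propositional.Properties
  using (∈-map⁺; ∈-map⁻; ∈-filter⁺; ∈-filter⁻; ∈-concatMap⁺; ∈-concatMap⁻)
open import Data.List.Membership.DecPropositional (≡-dec ℕ._≟_) using (_∈?_)
import Data.List.Relation.Unary.All as All
open import Relation.Binary.PropositionalEquality using (_≡_; refl; sym; trans; cong; subst)
open import Relation.Nullary using (¬_; Dec; yes; no)
open import Relation.Nullary.Decidable using (map′; _×-dec_; _→-dec_)
open import Relation.Unary using (Decidable; _≐_)
open import Relation.Unary.Properties using (≐-refl; ≐-sym)
open import Function using (_∘_; case_of_)
open import Function.Bundles using (_⇔_; mk⇔)

_≟ₛ_ : (σ τ : String) → Dec (σ ≡ τ)
_≟ₛ_ = ≡-dec ℕ._≟_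

≼-refl : ∀ σ → σ ≼ σ
≼-refl σ = [] , ++-identityʳ σ

≼-trans : ∀ {σ τ υ} → σ ≼ τ → τ ≼ υ → σ ≼ υ
≼-trans {σ} (r , refl) (s , refl) = r ++ s , sym (++-assoc σ r s)

∷-≼ : ∀ {x σ τ} → σ ≼ τ → (x ∷ σ) ≼ (x ∷ τ)
∷-≼ {x} (r , e) = r , cong (x ∷_) e

_≼?_ : (σ τ : String) → Dec (σ ≼ τ)
[] ≼? τ = yes (τ , refl)
(x ∷ σ) ≼? [] = no λ ()
(x ∷ σ) ≼? (y ∷ τ) with x ℕ.≟ y | σ ≼? τ
... | no x≢y | _ = no λ (_ , e) → x≢y (proj₁ (∷-injective e))
... | yes refl | no σ⋠τ = no λ (r , e) → σ⋠τ (r , proj₂ (∷-injective e))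
... | yes refl | yes σ≼τ = yes (∷-≼ σ≼τ)

≼-comparable : ∀ {σ σ' τ} → σ ≼ τ → σ' ≼ τ → σ ≼ σ' ⊎ σ' ≼ σ
≼-comparable {[]} _ _ = inj₁ (_ , refl)
≼-comparable {_ ∷ _} {[]} _ _ = inj₂ (_ , refl)
≼-comparable {x ∷ σ} {_ ∷ σ'} (r , refl) (s , e) with ∷-injective e
... | refl , e' = Sum.map ∷-≼ ∷-≼ (≼-comparable {σ} {σ'} (r , refl) (s , e'))

≼-maximal : ∀ {ρ τ} → ρ ≼ τ → length τ ≤ length ρ → ρ ≡ τ
≼-maximal {ρ} (r , refl) |ρr|≤|ρ| = sym (trans (cong (ρ ++_) (no-room ρ r |ρr|≤|ρ|)) (++-identityʳ ρ))
  where
  no-room : ∀ ρ r → length (ρ ++ r) ≤ length ρ → r ≡ []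
  no-room [] [] _ = refl
  no-room (_ ∷ ρ) r (s≤s le) = no-room ρ r le

-- In a prefix-free set, an initial segment of τ belonging to it is unique
-- (this is what makes τ^{-D} well defined).
prefixFree-unique : ∀ {D σ σ' τ} → PrefixFree D →
  D σ → D σ' → σ ≼ τ → σ' ≼ τ → σ ≡ σ'
prefixFree-unique {σ = σ} {σ'} pf dσ dσ' σ≼τ σ'≼τ with ≼-comparable σ≼τ σ'≼τ
... | inj₁ σ≼σ' = pf σ σ' dσ dσ' σ≼σ'
... | inj₂ σ'≼σ = sym (pf σ' σ dσ' dσ σ'≼σ)

Leaf-resp : ∀ {P Q τ} → P ≐ Q → Leaf P τ → Leaf Q τ
Leaf-resp (P⊆Q , Q⊆P) (pτ , maximal) = P⊆Q pτ , λ τ' qτ' → maximal τ' (Q⊆P qτ')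

Forest-resp : ∀ {D P Q} → P ≐ Q → Forest D P → Forest D Q
Forest-resp (P⊆Q , Q⊆P) (above , trees) =
  (λ τ qτ → above τ (Q⊆P qτ)) ,
  λ σ dσ → let ((τ , pτ , σ≼τ) , closed) = trees σ dσ in
    (τ , P⊆Q pτ , σ≼τ) , λ τ ρ qτ σ≼τ ρ≼τ len → P⊆Q (closed τ ρ (Q⊆P qτ) σ≼τ ρ≼τ len)

Bushy-resp : ∀ h {P Q} → P ≐ Q → Bushy h P → Bushy h Q
Bushy-resp h P≐Q@(P⊆Q , Q⊆P) bushy τ qτ notLeaf =
  let (ns , unique , enough , succs) = bushy τ (Q⊆P qτ) (notLeaf ∘ Leaf-resp P≐Q) in
  ns , unique , enough , All.map P⊆Q succs

EndExt-resp : ∀ {P P' Q Q'} → P ≐ P' → Q ≐ Q' → EndExt P Q → EndExt P' Q'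
EndExt-resp P≐P'@(P⊆P' , P'⊆P) (Q⊆Q' , Q'⊆Q) (P⊆Q , new) =
  (λ ρ p'ρ → Q⊆Q' (P⊆Q ρ (P'⊆P p'ρ))) ,
  λ ρ q'ρ notP'ρ → let (λ' , leaf , λ'≼ρ) = new ρ (Q'⊆Q q'ρ) (notP'ρ ∘ P⊆P') in
    λ' , Leaf-resp P≐P' leaf , λ'≼ρ

EndExt-refl : ∀ {P} → EndExt P P
EndExt-refl = (λ ρ pρ → pρ) , λ ρ pρ notPρ → ⊥-elim (notPρ pρ)

module PrefixFreeForest {D : StrSet} (pf : PrefixFree D) where

  leaf : ∀ {τ} → D τ → Leaf D τ
  leaf {τ} dτ = dτ , λ τ' dτ' τ≼τ' → sym (pf τ τ' dτ dτ' τ≼τ')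

  forest : Forest D D
  forest =
    (λ τ dτ → τ , dτ , ≼-refl τ) ,
    λ σ dσ → (σ , dσ , ≼-refl σ) , λ τ ρ dτ σ≼τ ρ≼τ |σ|≤|ρ| →
      let |τ|≤|ρ| = subst (λ υ → length υ ≤ length ρ) (pf σ τ dσ dτ σ≼τ) |σ|≤|ρ| in
      subst D (sym (≼-maximal ρ≼τ |τ|≤|ρ|)) dτ

  bushy : ∀ h → Bushy h D
  bushy h τ dτ notLeaf = ⊥-elim (notLeaf (leaf dτ))

  endExtendedBy : ∀ {G} → Forest D G → EndExt D G
  endExtendedBy (above , trees) =
    (λ σ dσ → let ((τ , gτ , σ≼τ) , closed) = trees σ dσ in
      closed τ σ gτ σ≼τ σ≼τ ≤-refl) ,
    λ ρ gρ _ → let (σ , dσ , σ≼ρ) = above ρ gρ in σ , leaf dσ , σ≼ρ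

image : ∀ {P : StrSet} → Decidable P → Pairs → List String
image P? A = map proj₂ (filter (P? ∘ proj₁) A)

∈-image⁺ : ∀ {P : StrSet} (P? : Decidable P) {A τ ρ} → (τ , ρ) ∈ A → P τ → ρ ∈ image P? A
∈-image⁺ P? τρ∈A pτ = ∈-map⁺ proj₂ (∈-filter⁺ (P? ∘ proj₁) τρ∈A pτ)

∈-image⁻ : ∀ {P : StrSet} (P? : Decidable P) {A ρ} → ρ ∈ image P? A → ∃[ τ ] ((τ , ρ) ∈ A × P τ)
∈-image⁻ P? ρ∈ with ∈-map⁻ proj₂ ρ∈
... | (τ , _) , τρ∈ , refl = τ , ∈-filter⁻ (P? ∘ proj₁) τρ∈

domList : Pairs → List String
domList T = map proj₁ T

domList-≐ : ∀ T → (_∈ domList T) ≐ Dom T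
domList-≐ T =
  (λ τ∈ → case ∈-map⁻ proj₁ τ∈ of λ { ((_ , ρ) , τρ∈T , refl) → ρ , τρ∈T }) ,
  (λ (_ , τρ∈T) → ∈-map⁺ proj₁ τρ∈T)

secList : Pairs → String → List String
secList T τ = image (_≟ₛ τ) T

secList-≐ : ∀ T τ → (_∈ secList T τ) ≐ Sec T τ
secList-≐ T τ =
  (λ ρ∈ → case ∈-image⁻ (_≟ₛ τ) ρ∈ of λ { (_ , τρ∈T , refl) → τρ∈T }) ,
  (λ τρ∈T → ∈-image⁺ (_≟ₛ τ) τρ∈T refl)

graph : List String → (String → List String) → Pairs
graph F S = concatMap (λ τ → map (τ ,_) (S τ)) F

∈-graph⁺ : ∀ {F S τ ρ} → τ ∈ F → ρ ∈ S τ → (τ , ρ) ∈ graph F S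
∈-graph⁺ {S = S} {τ} τ∈F ρ∈Sτ = ∈-concatMap⁺ (λ τ → map (τ ,_) (S τ)) (lose τ∈F (∈-map⁺ (τ ,_) ρ∈Sτ))

∈-graph⁻ : ∀ F S {τ ρ} → (τ , ρ) ∈ graph F S → τ ∈ F × ρ ∈ S τ
∈-graph⁻ F S τρ∈ with find (∈-concatMap⁻ (λ τ → map (τ ,_) (S τ)) τρ∈)
... | τ , τ∈F , τρ∈' with ∈-map⁻ (τ ,_) τρ∈'
...   | ρ , ρ∈Sτ , refl = τ∈F , ρ∈Sτ

leaf? : ∀ (F : List String) τ → Dec (Leaf (_∈ F) τ)
leaf? F τ =
  map′ (λ (τ∈F , maxs) → τ∈F , λ τ' τ'∈F τ≼τ' → All.lookup maxs τ'∈F τ≼τ')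
       (λ (τ∈F , maximal) → τ∈F , All.tabulate λ {τ'} τ'∈F → maximal τ' τ'∈F)
       ((τ ∈? F) ×-dec All.all? (λ τ' → (τ ≼? τ') →-dec (τ' ≟ₛ τ)) F)

BigSections : Pairs → (ℕ → ℕ) → PairSet → StrSet
BigSections A h B τ = ∃[ σ ] (Dom A σ × σ ≼ τ × Big h (Sec A σ) (B τ))

systemToBig : ∀ {A} g h {B T} → ForestSystem A T → BushySys g h T →
  (∀ τ ρ → LeafSys T τ ρ → B τ ρ) → Big g (Dom A) (BigSections A h B)
systemToBig {A} g h {B} {T} (domForest , secForest , _) (domBushy , secBushy) leavesInB =
  domList T ,
  Forest-resp (≐-sym (domList-≐ T)) domForest ,
  Bushy-resp g (≐-sym (domList-≐ T)) domBushy ,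
  leafBig
  where
  leafBig : ∀ τ → Leaf (_∈ domList T) τ → BigSections A h B τ
  leafBig τ τ-leaf =
    let τ-leafᵀ = Leaf-resp (domList-≐ T) τ-leaf
        τ∈T = proj₁ τ-leafᵀ
        (σ , σ∈A , σ≼τ) = proj₁ domForest τ τ∈T
        secᵀ = ≐-sym (secList-≐ T τ)
    in σ , σ∈A , σ≼τ , secList T τ ,
       Forest-resp secᵀ (secForest τ τ∈T σ σ∈A σ≼τ) ,
       Bushy-resp h secᵀ (secBushy τ τ∈T) ,
       λ ρ ρ-leaf → let ρ-leafᵀ = Leaf-resp (secList-≐ T τ) ρ-leaf in
         leavesInB τ ρ (proj₁ ρ-leafᵀ , τ-leafᵀ , ρ-leafᵀ)

module BigToSystem (A : Pairs) (pfA : PrefixFreePairs A) (g h : ℕ → ℕ) (B : PairSet)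
  (F : List String) (F-forest : Forest (Dom A) (_∈ F)) (F-bushy : Bushy g (_∈ F))
  (F-leaves : ∀ τ → Leaf (_∈ F) τ → BigSections A h B τ) where

  secBelow : String → List String
  secBelow τ = image (_≼? τ) A

  secBelow-≐ : ∀ {σ τ} → Dom A σ → σ ≼ τ → (_∈ secBelow τ) ≐ Sec A σ
  secBelow-≐ {τ = τ} σ∈A σ≼τ =
    (λ ρ∈ → let (σ' , σ'ρ∈A , σ'≼τ) = ∈-image⁻ (_≼? τ) ρ∈ in
      subst (λ υ → (υ , _) ∈ A) (prefixFree-unique (proj₁ pfA) (_ , σ'ρ∈A) σ∈A σ'≼τ σ≼τ) σ'ρ∈A) ,
    (λ σρ∈A → ∈-image⁺ (_≼? τ) σρ∈A σ≼τ)

  S : String → List String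
  S τ with leaf? F τ
  ... | yes τ-leaf = let (_ , _ , _ , G , _) = F-leaves τ τ-leaf in G
  ... | no _ = secBelow τ

  S-forest : ∀ {σ τ} → Dom A σ → σ ≼ τ → Forest (Sec A σ) (_∈ S τ)
  S-forest {σ} {τ} σ∈A σ≼τ with leaf? F τ
  ... | yes τ-leaf =
    let (σ' , σ'∈A , σ'≼τ , G , G-forest , _) = F-leaves τ τ-leaf in
    subst (λ υ → Forest (Sec A υ) (_∈ G)) (prefixFree-unique (proj₁ pfA) σ'∈A σ∈A σ'≼τ σ≼τ) G-forest
  ... | no _ = Forest-resp (≐-sym (secBelow-≐ σ∈A σ≼τ)) (PrefixFreeForest.forest (proj₂ pfA σ))

  S-bushy : ∀ {σ τ} → Dom A σ → σ ≼ τ → Bushy h (_∈ S τ)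
  S-bushy {σ} {τ} σ∈A σ≼τ with leaf? F τ
  ... | yes τ-leaf = let (_ , _ , _ , _ , _ , G-bushy , _) = F-leaves τ τ-leaf in G-bushy
  ... | no _ = Bushy-resp h (≐-sym (secBelow-≐ σ∈A σ≼τ)) (PrefixFreeForest.bushy (proj₂ pfA σ) h)

  S-inner : ∀ {σ τ} → ¬ Leaf (_∈ F) τ → Dom A σ → σ ≼ τ → (_∈ S τ) ≐ Sec A σ
  S-inner {τ = τ} notLeaf σ∈A σ≼τ with leaf? F τ
  ... | yes τ-leaf = ⊥-elim (notLeaf τ-leaf)
  ... | no _ = secBelow-≐ σ∈A σ≼τ

  S-leaves : ∀ {τ} → Leaf (_∈ F) τ → ∀ ρ → Leaf (_∈ S τ) ρ → B τ ρ
  S-leaves {τ} τ-leaf with leaf? F τ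
  ... | yes τ-leaf' = let (_ , _ , _ , _ , _ , _ , G-leaves) = F-leaves τ τ-leaf' in G-leaves
  ... | no notLeaf = ⊥-elim (notLeaf τ-leaf)

  -- Sections along a branch of F end-extend each other: either τ = τ', or τ
  -- is an inner node, where S(τ) = A(σ) is prefix-free and S(τ') a forest above it.
  S-endExt : ∀ {τ τ'} → τ ∈ F → τ' ∈ F → τ ≼ τ' → EndExt (_∈ S τ) (_∈ S τ')
  S-endExt {τ} {τ'} τ∈F τ'∈F τ≼τ' with τ ≟ₛ τ'
  ... | yes refl = EndExt-refl
  ... | no τ≢τ' =
    let (σ , σ∈A , σ≼τ) = proj₁ F-forest τ τ∈F
        notLeaf τ-leaf = τ≢τ' (sym (proj₂ τ-leaf τ' τ'∈F τ≼τ'))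
    in EndExt-resp (≐-sym (S-inner notLeaf σ∈A σ≼τ)) ≐-refl
         (PrefixFreeForest.endExtendedBy (proj₂ pfA σ) (S-forest σ∈A (≼-trans σ≼τ τ≼τ')))

  T : Pairs
  T = graph F S

  -- Every section over a node of F is nonempty (it is a forest above the
  -- nonempty A(σ)), so dom T = F.
  dom-T : Dom T ≐ (_∈ F)
  dom-T =
    (λ (_ , τρ∈T) → proj₁ (∈-graph⁻ F S τρ∈T)) ,
    λ {τ} τ∈F →
      let (σ , (ρ , σρ∈A) , σ≼τ) = proj₁ F-forest τ τ∈F
          ((ρ' , ρ'∈Sτ , _) , _) = proj₂ (S-forest (ρ , σρ∈A) σ≼τ) ρ σρ∈A
      in ρ' , ∈-graph⁺ τ∈F ρ'∈Sτ

  sec-T : ∀ {τ} → τ ∈ F → Sec T τ ≐ (_∈ S τ)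
  sec-T τ∈F = (λ τρ∈T → proj₂ (∈-graph⁻ F S τρ∈T)) , ∈-graph⁺ τ∈F

  forestSystem : ForestSystem A T
  forestSystem =
    Forest-resp (≐-sym dom-T) F-forest ,
    (λ τ τ∈T σ σ∈A σ≼τ →
      Forest-resp (≐-sym (sec-T (proj₁ dom-T τ∈T))) (S-forest σ∈A σ≼τ)) ,
    λ τ τ' τ∈T τ'∈T τ≼τ' →
      EndExt-resp (≐-sym (sec-T (proj₁ dom-T τ∈T))) (≐-sym (sec-T (proj₁ dom-T τ'∈T)))
        (S-endExt (proj₁ dom-T τ∈T) (proj₁ dom-T τ'∈T) τ≼τ')

  bushySystem : BushySys g h T
  bushySystem =
    Bushy-resp g (≐-sym dom-T) F-bushy ,
    λ τ τ∈T → let τ∈F = proj₁ dom-T τ∈T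
                  (σ , σ∈A , σ≼τ) = proj₁ F-forest τ τ∈F
              in Bushy-resp h (≐-sym (sec-T τ∈F)) (S-bushy σ∈A σ≼τ)

  leavesInB : ∀ τ ρ → LeafSys T τ ρ → B τ ρ
  leavesInB τ ρ (τρ∈T , τ-leaf , ρ-leaf) =
    S-leaves (Leaf-resp dom-T τ-leaf) ρ (Leaf-resp (sec-T (proj₁ (∈-graph⁻ F S τρ∈T))) ρ-leaf)

lemma3p7 : (A : Pairs) → PrefixFreePairs A →
    (g h : ℕ → ℕ) → Bounding g → Bounding h → (B : PairSet) →
    (∃[ T ] (ForestSystem A T × BushySys g h T × (∀ τ ρ → LeafSys T τ ρ → B τ ρ)))
    ⇔ Big g (Dom A) (λ τ → ∃[ σ ] (Dom A σ × σ ≼ τ × Big h (Sec A σ) (B τ)))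
lemma3p7 A pfA g h _ _ B = mk⇔
  (λ (T , T-system , T-bushy , T-leaves) → systemToBig g h T-system T-bushy T-leaves)
  (λ (F , F-forest , F-bushy , F-leaves) →
    let open BigToSystem A pfA g h B F F-forest F-bushy F-leaves
    in T , forestSystem , bushySystem , leavesInB)
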